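{- Let $\hat D$ be a co-loopless Le-diagram of type $(k,n)$ and let $D$ be the filling produced from $\hat D$ by the algorithm described in the context. Then $D$ is loopless (every column of $D$ contains a $+$) and has dimension $\dim(S_D)=\dim(S_{\hat D})-2k+(n-1)$, i.e. the number of $+$'s in $D$ equals the number of $+$'s in $\hat D$ minus $2k$ plus $n-1$.
   Context: Le-diagrams. For $0\le k\le n$, a Le-diagram of type $(k,n)$ is a filling of a Young diagram $\lambda$ (English convention, in the top-left corner of a $k\times(n-k)$ rectangle and fitting inside it) with $0$ and $+$ such that no box containing $0$ has both a $+$ above it in its column and a $+$ to its left in its row. The south-east boundary of $\lambda$ is a lattice path of $n$ unit steps from the top-right to the bottom-left corner of the rectangle, with steps labelled $1,\dots,n$ in order; vertical step labels are row labels (rows may have length $0$), horizontal step labels are column labels. Box $(i,j)$ is the box in row $i$, column $j$ (existing only inside $\lambda$, with $i<j$). "Below" = larger row label, "to the left" = larger column label. The decorated permutation $\hat\pi$ of $\hat D$ is read from the pipe dream: each $0$ becomes a crossing, each $+$ an elbow (entering from bottom exits left, entering from right exits top); north-west boundary ends of rows/columns carry the same labels; the pipe from boundary step $i$ (moving left from a row label, up from a column label) exits at $j$ and $\hat\pi(i)=j$. $\hat D$ is co-loopless if every row is nonempty and contains a $+$ (no co-loops). The positroid cell $S_D$ indexed by a Le-diagram $D$ has dimension equal to the number of $+$'s in $D$. The algorithm. Let the row labels of $\hat D$ be $b_1<\dots<b_k$ and $a_n=\hat\pi(1)$. $D$ has the Young-diagram shape of type $(k+1,n)$ with row labels $\{b_1,\dots,b_k,a_n\}$.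 $L_u$ = column label of the leftmost $+$ in row $b_u$ of $\hat D$; for row $a_n$ set $L=\infty$ and regard its row in $\hat D$ as all $0$'s. $W(r)$ = label of the next row of $D$ below row $r$, or $n+1$ for the last row. A $0$ of $\hat D$ is restricted if some box to its left in its row contains $+$, else unrestricted. For row $r$ and column $\ell$ of $D$: (i) $\hat D$ has $+$ at $(r,\ell)$ (never for $r=a_n$); (ii) some row label $b'>r$ of $\hat D$ has $+$ at $(b',\ell)$ with every box $(b,\ell)$ of $\hat D$, $b$ a row label, $r<b<b'$, containing an unrestricted $0$; (iii) every existing box $(b,\ell)$ of $\hat D$ with $b>r$ a row label contains an unrestricted $0$. Row types: (I) rows $b_u$ with box $(b_u,a_n)$ of $\hat D$ nonexistent or $0$; (II) rows $b_u$ with $+$ at $(b_u,a_n)$; (III) row $a_n$. Type (I)/(III) row $r$ with $L$ and $W=W(r)$: box $(r,\ell)$ gets $+$ if $r<\ell<\min(W,L)$; if $W<\ell<L$, $+$ iff (i), (ii) or (iii) holds, else $0$; $0$ if $\ell\ge L$. Type (II) row $r$: boxes with $\ell<a_n$ follow the type (I) rule; boxes with $\ell>a_n$ get $+$ exactly when $\hat D$ has $+$ at $(r,\ell)$. -}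

module Defs where

open import Data.Nat using (ℕ; zero; suc; _+_; _*_; _∸_; _≤_; _<_; _<ᵇ_; _≡ᵇ_)
open import Data.Bool using (Bool; true; false; not; _∧_; _∨_; if_then_else_)
open import Data.Maybe using (Maybe; just; nothing; maybe; fromMaybe)
open import Data.Product using (Σ; _×_; ∃; ∃-syntax)
open import Data.Empty using (⊥)
open import Relation.Binary.PropositionalEquality using (_≡_)

-- Boundary step labels are the natural numbers 1,…,n.
-- A filling is described by
--   isRow : ℕ → Bool          (label i is a row label = vertical step)
--   plus  : ℕ → ℕ → Bool      (box (i,j) contains + ; true = +, false = 0)
-- Only values at labels 1..n (and existing boxes (i,j): i row, j column,
-- i < j) are ever consulted; other values are irrelevant junk.

count : (ℕ → Bool) → ℕ → ℕ
count p zero = zero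
count p (suc m) = (if p (suc m) then 1 else 0) + count p m

sumTo : (ℕ → ℕ) → ℕ → ℕ
sumTo f zero = zero
sumTo f (suc m) = f (suc m) + sumTo f m

anyTo : (ℕ → Bool) → ℕ → Bool
anyTo p zero = false
anyTo p (suc m) = p (suc m) ∨ anyTo p m

allTo : (ℕ → Bool) → ℕ → Bool
allTo p zero = true
allTo p (suc m) = p (suc m) ∧ allTo p m

firstFrom : (ℕ → Bool) → ℕ → ℕ → Maybe ℕ
firstFrom p i zero = nothing
firstFrom p i (suc m) = if p i then just i else firstFrom p (suc i) m

lastIn : (ℕ → Bool) → ℕ → Maybe ℕ
lastIn p zero = nothing
lastIn p (suc m) = if p (suc m) then just (suc m) else lastIn p m

-- box (i,j) exists (inside the Young diagram, labels ≤ n assumed)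
boxExists : (ℕ → Bool) → ℕ → ℕ → Bool
boxExists isRow i j = isRow i ∧ not (isRow j) ∧ (i <ᵇ j)

plusAt : (ℕ → Bool) → (ℕ → ℕ → Bool) → ℕ → ℕ → Bool
plusAt isRow plus i j = boxExists isRow i j ∧ plus i j

zeroAt : (ℕ → Bool) → (ℕ → ℕ → Bool) → ℕ → ℕ → Bool
zeroAt isRow plus i j = boxExists isRow i j ∧ not (plus i j)

-- number of +'s of a filling of type (_, n)  (= dim of the positroid cell)
numPlus : ℕ → (ℕ → Bool) → (ℕ → ℕ → Bool) → ℕ
numPlus n isRow plus = sumTo (λ i → count (λ j → plusAt isRow plus i j) n) n

record LeDiagram (k n : ℕ) : Set where
  field
    isRow : ℕ → Bool
    plus  : ℕ → ℕ → Bool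
    rowCount : count isRow n ≡ k
    -- Le-property: no 0 with a + above it in its column and a + to its
    -- left (larger column label) in its row
    le : ∀ i j i' j' → 1 ≤ i' → j' ≤ n →
         zeroAt isRow plus i j ≡ true →
         i' < i → plusAt isRow plus i' j ≡ true →
         j < j' → plusAt isRow plus i j' ≡ true → ⊥

open LeDiagram public

CoLoopless : ∀ {k n} → LeDiagram k n → Set
CoLoopless {k} {n} D = ∀ b → 1 ≤ b → b ≤ n → isRow D b ≡ true →
  ∃[ j ] (j ≤ n × plusAt (isRow D) (plus D) b j ≡ true)

Loopless : ℕ → (ℕ → Bool) → (ℕ → ℕ → Bool) → Set
Loopless n isRow plus = ∀ ℓ → 1 ≤ ℓ → ℓ ≤ n → isRow ℓ ≡ false →
  ∃[ r ] (1 ≤ r × plusAt isRow plus r ℓ ≡ true)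

data Dir : Set where
  goLeft goUp : Dir

module Pipes (n : ℕ) (isRow : ℕ → Bool) (plus : ℕ → ℕ → Bool) where

  nextCol : ℕ → Maybe ℕ
  nextCol c = firstFrom (λ j → not (isRow j)) (suc c) (n ∸ c)

  prevRow : ℕ → Maybe ℕ
  prevRow r = lastIn isRow (r ∸ 1)

  -- the pipe has just entered box (r,c) travelling in direction d;
  -- 0 = crossing (keep direction), + = elbow (left ↦ up, up ↦ left).
  -- The fuel (2n+2) always suffices since every step increases the column
  -- or decreases the row; the fuel-exhausted value 0 is never reached.
  trace : ℕ → Dir → ℕ → ℕ → ℕ
  trace zero d r c = 0
  trace (suc f) d r c = move (turn d (plus r c))
    where
    turn : Dir → Bool → Dir
    turn goLeft true = goUp
    turn goUp true = goLeft
    turn d' false = d'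
    move : Dir → ℕ
    move goLeft = maybe (λ c' → trace f goLeft r c') r (nextCol c)
    move goUp = maybe (λ r' → trace f goUp r' c) c (prevRow r)

  -- π̂(i): the pipe starting at boundary step i (leftwards from a row label,
  -- upwards from a column label) exits at the north-west boundary label π̂(i)
  perm : ℕ → ℕ
  perm i = if isRow i
           then maybe (λ c → trace (2 * n + 2) goLeft i c) i (nextCol i)
           else maybe (λ r → trace (2 * n + 2) goUp r i) i (prevRow i)

decPerm : ∀ {k n} → LeDiagram k n → ℕ → ℕ
decPerm {k} {n} D = Pipes.perm n (isRow D) (plus D)

module Algorithm {k n : ℕ} (Dh : LeDiagram k n) where

  R̂ = isRow Dh
  P̂ = plus Dh

  aₙ : ℕ
  aₙ = decPerm Dh 1

  rowD : ℕ → Bool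
  rowD r = R̂ r ∨ (r ≡ᵇ aₙ)

  -- L(r): column label of leftmost + (largest column label) in row r of D̂;
  -- nothing represents L = ∞ (used for row a_n)
  Lof : ℕ → Maybe ℕ
  Lof r = if r ≡ᵇ aₙ then nothing else lastIn (λ j → plusAt R̂ P̂ r j) n

  ltL : ℕ → ℕ → Bool
  ltL r ℓ = maybe (λ L → ℓ <ᵇ L) true (Lof r)

  W : ℕ → ℕ
  W r = fromMaybe (suc n) (firstFrom rowD (suc r) (n ∸ r))

  plusLeft : ℕ → ℕ → Bool
  plusLeft b ℓ = anyTo (λ j' → (ℓ <ᵇ j') ∧ plusAt R̂ P̂ b j') n

  unrestrictedZero : ℕ → ℕ → Bool
  unrestrictedZero b ℓ = zeroAt R̂ P̂ b ℓ ∧ not (plusLeft b ℓ)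

  condI : ℕ → ℕ → Bool
  condI r ℓ = plusAt R̂ P̂ r ℓ

  condII : ℕ → ℕ → Bool
  condII r ℓ = anyTo (λ b' → (r <ᵇ b') ∧ plusAt R̂ P̂ b' ℓ ∧
                 allTo (λ b → not (R̂ b ∧ (r <ᵇ b) ∧ (b <ᵇ b'))
                              ∨ unrestrictedZero b ℓ) n) n

  condIII : ℕ → ℕ → Bool
  condIII r ℓ = allTo (λ b → not (R̂ b ∧ (r <ᵇ b) ∧ boxExists R̂ b ℓ)
                             ∨ unrestrictedZero b ℓ) n

  ruleI : ℕ → ℕ → Bool
  ruleI r ℓ =
    if ltL r ℓ ∧ (ℓ <ᵇ W r) then true
    else if ltL r ℓ ∧ (W r <ᵇ ℓ) then (condI r ℓ ∨ condII r ℓ ∨ condIII r ℓ)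
    else false

  typeII : ℕ → Bool
  typeII r = R̂ r ∧ plusAt R̂ P̂ r aₙ

  plusD : ℕ → ℕ → Bool
  plusD r ℓ = if typeII r
              then (if ℓ <ᵇ aₙ then ruleI r ℓ else plusAt R̂ P̂ r ℓ)
              else ruleI r ℓ

algRow : ∀ {k n} → LeDiagram k n → ℕ → Bool
algRow Dh = Algorithm.rowD Dh

algPlus : ∀ {k n} → LeDiagram k n → ℕ → ℕ → Bool
algPlus Dh = Algorithm.plusD Dh

-- Count the +'s column by column.  The pipe from step 1 leaves row 1 at its first elbow, so
-- aₙ = π̂(1) is the first + of row 1 (or 1 itself when 1 is a column label).  Charge every row b
-- of D̂ to one column: to aₙ if D̂ has + at (b, aₙ), to its leftmost + otherwise.  For every label ℓ,
--   #(+ of D in column ℓ) + #(rows charged to ℓ) + [ℓ row of D̂] + [ℓ = aₙ] = #(+ of D̂ in column ℓ) + 1,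
-- and summing over ℓ gives dim D + k + k + 1 = dim D̂ + n.  For a column ℓ ≠ aₙ the identity follows
-- by scanning the rows from the top while tracking the flag "no 0 of column ℓ below the current row
-- is restricted", which is exactly (ii) ∨ (iii): in each row, the +'s of D and charges gained equal
-- the +'s of D̂ gained plus the change of the flag.
-- A row charged to ℓ ≠ aₙ has a + in column ℓ, so the same identity forces a + in every column of D.

module Submission where

open import Defs
open import Data.Bool using (Bool; true; false; not; _∧_; _∨_; if_then_else_)
open import Data.Bool.Properties
  using (T-≡; not-¬; not-injective; ∧-conicalˡ; ∧-conicalʳ; ∨-conicalˡ; ∨-conicalʳ; ∧-zeroʳ)
open import Data.Empty using (⊥; ⊥-elim)
open import Data.Maybe using (just; nothing; maybe; fromMaybe)
open import Data.Nat using (ℕ; zero; suc; _+_; _*_; _∸_; _≤_; _<_; _<ᵇ_; _≡ᵇ_; z≤n; s≤s; _≤?_)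
open import Data.Nat.Properties
open import Algebra.Properties.CommutativeSemigroup +-commutativeSemigroup using (interchange)
open import Data.Nat.Solver using (module +-*-Solver)
open import Data.Product using (_×_; _,_; proj₁; proj₂; ∃-syntax)
open import Data.Sum using (_⊎_; inj₁; inj₂; [_,_]′)
open import Function using (_∘_)
open import Function.Bundles using (Equivalence)
open import Relation.Binary.Definitions using (Tri; tri<; tri≈; tri>)
open import Relation.Binary.PropositionalEquality
open import Relation.Nullary using (yes; no)
open import Relation.Nullary.Reflects using (ofʸ; ofⁿ)

open +-*-Solver using (solve; _:+_; _:*_; _:=_; con)

toℕ : Bool → ℕ
toℕ b = if b then 1 else 0

<⇒<ᵇ≡true : ∀ {m n} → m < n → (m <ᵇ n) ≡ true
<⇒<ᵇ≡true {m} {n} m<n with m <ᵇ n | <ᵇ-reflects-< m n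
... | true  | _ = refl
... | false | ofⁿ m≮n = ⊥-elim (m≮n m<n)

≥⇒<ᵇ≡false : ∀ {m n} → n ≤ m → (m <ᵇ n) ≡ false
≥⇒<ᵇ≡false {m} {n} n≤m with m <ᵇ n | <ᵇ-reflects-< m n
... | false | _ = refl
... | true  | ofʸ m<n = ⊥-elim (<⇒≱ m<n n≤m)

<ᵇ≡true⇒< : ∀ {m n} → (m <ᵇ n) ≡ true → m < n
<ᵇ≡true⇒< {m} {n} eq = <ᵇ⇒< m n (Equivalence.from T-≡ eq)

<ᵇ≡false⇒≥ : ∀ {m n} → (m <ᵇ n) ≡ false → n ≤ m
<ᵇ≡false⇒≥ {m} {n} eq with m <ᵇ n | <ᵇ-reflects-< m n
... | false | ofⁿ m≮n = ≮⇒≥ m≮n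

≡⇒≡ᵇ≡true : ∀ {m n} → m ≡ n → (m ≡ᵇ n) ≡ true
≡⇒≡ᵇ≡true {m} {n} m≡n = Equivalence.to T-≡ (≡⇒≡ᵇ m n m≡n)

≢⇒≡ᵇ≡false : ∀ {m n} → m ≢ n → (m ≡ᵇ n) ≡ false
≢⇒≡ᵇ≡false {m} {n} m≢n with m ≡ᵇ n in eq
... | false = refl
... | true  = ⊥-elim (m≢n (≡ᵇ⇒≡ m n (Equivalence.from T-≡ eq)))

≡ᵇ≡true⇒≡ : ∀ {m n} → (m ≡ᵇ n) ≡ true → m ≡ n
≡ᵇ≡true⇒≡ {m} {n} eq = ≡ᵇ⇒≡ m n (Equivalence.from T-≡ eq)

<ᵇ-suc : ∀ {y b} → b ≢ suc y → (y <ᵇ b) ≡ (suc y <ᵇ b)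
<ᵇ-suc {y} {b} b≢1+y with y <ᵇ b | <ᵇ-reflects-< y b
... | true  | ofʸ y<b = sym (<⇒<ᵇ≡true (≤∧≢⇒< y<b (λ eq → b≢1+y (sym eq))))
... | false | ofⁿ y≮b = sym (≥⇒<ᵇ≡false (≤-trans (≮⇒≥ y≮b) (n≤1+n y)))

not≡false⇒≢false : ∀ {b} → not b ≡ false → b ≢ false
not≡false⇒≢false eq b≡false = not-¬ (cong not b≡false) eq

true-or-false : ∀ b → b ≡ true ⊎ b ≡ false
true-or-false true  = inj₁ refl
true-or-false false = inj₂ refl

∨≡true⇒ : ∀ {a b} → a ∨ b ≡ true → a ≡ true ⊎ b ≡ true
∨≡true⇒ {true}  _ = inj₁ refl
∨≡true⇒ {false} b = inj₂ b

∨-introˡ : ∀ {a b} → a ≡ true → a ∨ b ≡ true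
∨-introˡ refl = refl

∨-introʳ : ∀ {a b} → b ≡ true → a ∨ b ≡ true
∨-introʳ {true}  _ = refl
∨-introʳ {false} b = b

∧³-intro : ∀ {a b c} → a ≡ true → b ≡ true → c ≡ true → a ∧ b ∧ c ≡ true
∧³-intro refl refl refl = refl

implies-elim : ∀ {a u} → not a ∨ u ≡ true → a ≡ true → u ≡ true
implies-elim h refl = h

implies-intro³ : ∀ a b c {u} → (a ≡ true → b ≡ true → c ≡ true → u ≡ true) → not (a ∧ b ∧ c) ∨ u ≡ true
implies-intro³ false b     c     h = refl
implies-intro³ true  false c     h = refl
implies-intro³ true  true  false h = refl
implies-intro³ true  true  true  h = ∨-introʳ (h refl refl refl)

OnLabels : (ℕ → Set) → ℕ → Set
OnLabels P m = ∀ j → 1 ≤ j → j ≤ m → P j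

OnLabels-pred : ∀ {P m} → OnLabels P (suc m) → OnLabels P m
OnLabels-pred h j 1≤j j≤m = h j 1≤j (m≤n⇒m≤1+n j≤m)

OnLabels-top : ∀ {P m} → OnLabels P (suc m) → P (suc m)
OnLabels-top h = h _ (s≤s z≤n) ≤-refl

≤-suc-≢ : ∀ {j m} → j ≤ suc m → j ≢ suc m → j ≤ m
≤-suc-≢ j≤1+m j≢1+m = ≤-pred (≤∧≢⇒< j≤1+m j≢1+m)

count-cong : ∀ {p q : ℕ → Bool} m → OnLabels (λ j → p j ≡ q j) m → count p m ≡ count q m
count-cong zero _ = refl
count-cong (suc m) h = cong₂ _+_ (cong toℕ (OnLabels-top h)) (count-cong m (OnLabels-pred h))

count-false : ∀ {p : ℕ → Bool} m → OnLabels (λ j → p j ≡ false) m → count p m ≡ 0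
count-false zero _ = refl
count-false {p} (suc m) h rewrite OnLabels-top {λ j → p j ≡ false} h = count-false m (OnLabels-pred h)

count-mono : ∀ {p q : ℕ → Bool} m → OnLabels (λ j → p j ≡ true → q j ≡ true) m → count p m ≤ count q m
count-mono zero _ = z≤n
count-mono {p} {q} (suc m) h with p (suc m) in eq
... | true  rewrite OnLabels-top h eq = s≤s (count-mono m (OnLabels-pred h))
... | false = ≤-trans (count-mono m (OnLabels-pred h)) (m≤n+m _ (toℕ (q (suc m))))

count-witness : ∀ {p : ℕ → Bool} m → 1 ≤ count p m → ∃[ j ] (1 ≤ j × j ≤ m × p j ≡ true)
count-witness {p} (suc m) h with p (suc m) in eq
... | true  = suc m , s≤s z≤n , ≤-refl , eq
... | false with count-witness m h
...   | j , 1≤j , j≤m , pj = j , 1≤j , m≤n⇒m≤1+n j≤m , pj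

count-≡ᵇ : ∀ v m → 1 ≤ v → v ≤ m → count (v ≡ᵇ_) m ≡ 1
count-≡ᵇ v zero 1≤v v≤0 = ⊥-elim (<⇒≱ 1≤v v≤0)
count-≡ᵇ v (suc m) 1≤v v≤1+m with v ≟ suc m
... | yes refl rewrite ≡⇒≡ᵇ≡true {suc m} refl =
  cong suc (count-false m (λ j _ j≤m → ≢⇒≡ᵇ≡false (λ eq → <-irrefl (sym eq) (s≤s j≤m))))
... | no v≢1+m rewrite ≢⇒≡ᵇ≡false v≢1+m = count-≡ᵇ v m 1≤v (≤-suc-≢ v≤1+m v≢1+m)

count≡sumTo : ∀ (p : ℕ → Bool) m → count p m ≡ sumTo (λ j → toℕ (p j)) m
count≡sumTo p zero = refl
count≡sumTo p (suc m) = cong (toℕ (p (suc m)) +_) (count≡sumTo p m)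

sumTo-cong : ∀ {f g : ℕ → ℕ} m → OnLabels (λ j → f j ≡ g j) m → sumTo f m ≡ sumTo g m
sumTo-cong zero _ = refl
sumTo-cong (suc m) h = cong₂ _+_ (OnLabels-top h) (sumTo-cong m (OnLabels-pred h))

sumTo-+ : ∀ (f g : ℕ → ℕ) m → sumTo (λ j → f j + g j) m ≡ sumTo f m + sumTo g m
sumTo-+ f g zero = refl
sumTo-+ f g (suc m) = trans (cong (f (suc m) + g (suc m) +_) (sumTo-+ f g m))
                            (interchange (f (suc m)) (g (suc m)) (sumTo f m) (sumTo g m))

sumTo-const : ∀ c m → sumTo (λ _ → c) m ≡ m * c
sumTo-const c zero = refl
sumTo-const c (suc m) = cong (c +_) (sumTo-const c m)

sumTo-swap : ∀ (f : ℕ → ℕ → ℕ) m m' →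
  sumTo (λ i → sumTo (f i) m) m' ≡ sumTo (λ j → sumTo (λ i → f i j) m') m
sumTo-swap f m zero = sym (trans (sumTo-const 0 m) (*-zeroʳ m))
sumTo-swap f m (suc m') = trans (cong (sumTo (f (suc m')) m +_) (sumTo-swap f m m'))
                                (sym (sumTo-+ (f (suc m')) (λ j → sumTo (λ i → f i j) m') m))

count-swap : ∀ (p : ℕ → ℕ → Bool) m m' →
  sumTo (λ i → count (p i) m) m' ≡ sumTo (λ j → count (λ i → p i j) m') m
count-swap p m m' = begin
  sumTo (λ i → count (p i) m) m'                              ≡⟨ sumTo-cong m' (λ i _ _ → count≡sumTo (p i) m) ⟩
  sumTo (λ i → sumTo (λ j → toℕ (p i j)) m) m'                ≡⟨ sumTo-swap (λ i j → toℕ (p i j)) m m' ⟩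
  sumTo (λ j → sumTo (λ i → toℕ (p i j)) m') m                ≡⟨ sumTo-cong m (λ j _ _ → count≡sumTo (λ i → p i j) m') ⟨
  sumTo (λ j → count (λ i → p i j) m') m                      ∎
  where open ≡-Reasoning

sumTo-telescope : ∀ (f g t : ℕ → ℕ) {e p} N →
  (∀ m → p ≤ m → m < N → f (suc m) + t m ≡ g (suc m) + t (suc m)) →
  sumTo f p + e ≡ sumTo g p + t p → p ≤ N → sumTo f N + e ≡ sumTo g N + t N
sumTo-telescope f g t {e} {p} zero step base p≤0 rewrite n≤0⇒n≡0 p≤0 = base
sumTo-telescope f g t {e} {p} (suc N) step base p≤1+N with p ≟ suc N
... | yes refl = base
... | no p≢1+N = +-cancelʳ-≡ (t N) _ _ (begin
  f (suc N) + sumTo f N + e + t N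
    ≡⟨ solve 4 (λ a b c d → a :+ b :+ c :+ d := (a :+ d) :+ (b :+ c)) refl (f (suc N)) (sumTo f N) e (t N) ⟩
  (f (suc N) + t N) + (sumTo f N + e)
    ≡⟨ cong₂ _+_ (step N p≤N ≤-refl) previous ⟩
  (g (suc N) + t (suc N)) + (sumTo g N + t N)
    ≡⟨ solve 4 (λ a b c d → (a :+ b) :+ (c :+ d) := a :+ c :+ b :+ d) refl (g (suc N)) (t (suc N)) (sumTo g N) (t N) ⟩
  g (suc N) + sumTo g N + t (suc N) + t N ∎)
  where
  open ≡-Reasoning
  p≤N : p ≤ N
  p≤N = ≤-suc-≢ p≤1+N p≢1+N
  previous : sumTo f N + e ≡ sumTo g N + t N
  previous = sumTo-telescope f g t N (λ m p≤m m<N → step m p≤m (m≤n⇒m≤1+n m<N)) base p≤N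

anyTo≡true : ∀ {p : ℕ → Bool} m j → 1 ≤ j → j ≤ m → p j ≡ true → anyTo p m ≡ true
anyTo≡true zero j 1≤j j≤0 _ = ⊥-elim (<⇒≱ 1≤j j≤0)
anyTo≡true {p} (suc m) j 1≤j j≤1+m pj with j ≟ suc m
... | yes refl rewrite pj = refl
... | no j≢1+m = ∨-introʳ (anyTo≡true m j 1≤j (≤-suc-≢ j≤1+m j≢1+m) pj)

anyTo-witness : ∀ {p : ℕ → Bool} m → anyTo p m ≡ true → ∃[ j ] (1 ≤ j × j ≤ m × p j ≡ true)
anyTo-witness {p} (suc m) h with p (suc m) in eq
... | true  = suc m , s≤s z≤n , ≤-refl , eq
... | false with anyTo-witness m h
...   | j , 1≤j , j≤m , pj = j , 1≤j , m≤n⇒m≤1+n j≤m , pj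

allTo≡true : ∀ {p : ℕ → Bool} m → OnLabels (λ j → p j ≡ true) m → allTo p m ≡ true
allTo≡true zero _ = refl
allTo≡true {p} (suc m) h rewrite OnLabels-top {λ j → p j ≡ true} h = allTo≡true m (OnLabels-pred h)

allTo-elim : ∀ {p : ℕ → Bool} m → allTo p m ≡ true → OnLabels (λ j → p j ≡ true) m
allTo-elim zero _ j 1≤j j≤0 = ⊥-elim (<⇒≱ 1≤j j≤0)
allTo-elim {p} (suc m) h j 1≤j j≤1+m with j ≟ suc m
... | yes refl = ∧-conicalˡ (p (suc m)) _ h
... | no j≢1+m = allTo-elim m (∧-conicalʳ (p (suc m)) _ h) j 1≤j (≤-suc-≢ j≤1+m j≢1+m)

lastIn-just : ∀ {p : ℕ → Bool} m L → lastIn p m ≡ just L →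
  1 ≤ L × L ≤ m × p L ≡ true × (∀ j → L < j → j ≤ m → p j ≡ false)
lastIn-just {p} (suc m) L h with p (suc m) in eq
lastIn-just {p} (suc m) .(suc m) refl | true = s≤s z≤n , ≤-refl , eq , λ j L<j j≤L → ⊥-elim (<⇒≱ L<j j≤L)
... | false with lastIn-just m L h
...   | 1≤L , L≤m , pL , above = 1≤L , m≤n⇒m≤1+n L≤m , pL , above′
  where
  above′ : ∀ j → L < j → j ≤ suc m → p j ≡ false
  above′ j L<j j≤1+m with j ≟ suc m
  ... | yes refl = eq
  ... | no j≢1+m = above j L<j (≤-suc-≢ j≤1+m j≢1+m)

lastIn-nothing : ∀ {p : ℕ → Bool} m → lastIn p m ≡ nothing → OnLabels (λ j → p j ≡ false) m
lastIn-nothing zero _ j 1≤j j≤0 = ⊥-elim (<⇒≱ 1≤j j≤0)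
lastIn-nothing {p} (suc m) h j 1≤j j≤1+m with p (suc m) in eq
... | false with j ≟ suc m
...   | yes refl = eq
...   | no j≢1+m = lastIn-nothing m h j 1≤j (≤-suc-≢ j≤1+m j≢1+m)

firstFrom-just : ∀ {p : ℕ → Bool} i m j → firstFrom p i m ≡ just j →
  i ≤ j × j < i + m × p j ≡ true × (∀ j′ → i ≤ j′ → j′ < j → p j′ ≡ false)
firstFrom-just {p} i (suc m) j h with p i in eq
firstFrom-just {p} i (suc m) .i refl | true =
  ≤-refl , m<m+n i (s≤s z≤n) , eq , λ j′ i≤j′ j′<i → ⊥-elim (<⇒≱ j′<i i≤j′)
... | false with firstFrom-just (suc i) m j h
...   | i<j , j<i+1+m , pj , before = <⇒≤ i<j , subst (j <_) (sym (+-suc i m)) j<i+1+m , pj , before′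
  where
  before′ : ∀ j′ → i ≤ j′ → j′ < j → p j′ ≡ false
  before′ j′ i≤j′ j′<j with i ≟ j′
  ... | yes refl = eq
  ... | no i≢j′ = before j′ (≤∧≢⇒< i≤j′ i≢j′) j′<j

firstFrom-nothing : ∀ {p : ℕ → Bool} i m → firstFrom p i m ≡ nothing → ∀ j → i ≤ j → j < i + m → p j ≡ false
firstFrom-nothing i zero _ j i≤j j<i+0 = ⊥-elim (<⇒≱ (subst (j <_) (+-identityʳ i) j<i+0) i≤j)
firstFrom-nothing {p} i (suc m) h j i≤j j<i+1+m with p i in eq
... | false with i ≟ j
...   | yes refl = eq
...   | no i≢j = firstFrom-nothing (suc i) m h j (≤∧≢⇒< i≤j i≢j) (subst (j <_) (+-suc i m) j<i+1+m)

module _ {R : ℕ → Bool} {i j : ℕ} where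

  boxExists-intro : R i ≡ true → R j ≡ false → i < j → boxExists R i j ≡ true
  boxExists-intro ri rj i<j rewrite ri | rj = <⇒<ᵇ≡true i<j

  boxExists-≥ : j ≤ i → boxExists R i j ≡ false
  boxExists-≥ j≤i with R i | R j
  ... | false | _     = refl
  ... | true  | true  = refl
  ... | true  | false = ≥⇒<ᵇ≡false j≤i

  boxExists-elim : boxExists R i j ≡ true → R i ≡ true × R j ≡ false × i < j
  boxExists-elim h with R i | R j
  ... | true  | false = refl , refl , <ᵇ≡true⇒< h

module _ {R : ℕ → Bool} {P : ℕ → ℕ → Bool} {i j : ℕ} where

  plusAt-box : R i ≡ true → R j ≡ false → i < j → plusAt R P i j ≡ P i j
  plusAt-box ri rj i<j rewrite ri | rj | <⇒<ᵇ≡true i<j = refl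

  zeroAt-box : R i ≡ true → R j ≡ false → i < j → zeroAt R P i j ≡ not (P i j)
  zeroAt-box ri rj i<j rewrite ri | rj | <⇒<ᵇ≡true i<j = refl

  plusAt-nonRow : R i ≡ false → plusAt R P i j ≡ false
  plusAt-nonRow ri rewrite ri = refl

  zeroAt-nonRow : R i ≡ false → zeroAt R P i j ≡ false
  zeroAt-nonRow ri rewrite ri = refl

  plusAt-nonColumn : R j ≡ true → plusAt R P i j ≡ false
  plusAt-nonColumn rj with R i
  ... | false = refl
  ... | true rewrite rj = refl

  plusAt-≥ : j ≤ i → plusAt R P i j ≡ false
  plusAt-≥ j≤i rewrite boxExists-≥ {R} j≤i = refl

  plusAt-elim : plusAt R P i j ≡ true → (R i ≡ true × R j ≡ false × i < j) × P i j ≡ true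
  plusAt-elim h = boxExists-elim {R} (∧-conicalˡ _ _ h) , ∧-conicalʳ _ _ h

  plusAt-column : plusAt R P i j ≡ true → R j ≡ false
  plusAt-column h = proj₁ (proj₂ (proj₁ (plusAt-elim h)))

  plusAt-< : plusAt R P i j ≡ true → i < j
  plusAt-< h = proj₂ (proj₂ (proj₁ (plusAt-elim h)))

  zeroAt-elim : zeroAt R P i j ≡ true → (R i ≡ true × R j ≡ false × i < j) × P i j ≡ false
  zeroAt-elim h = boxExists-elim {R} (∧-conicalˡ _ _ h) , not-injective (∧-conicalʳ _ _ h)

module Construction {k n : ℕ} (Dh : LeDiagram k n) (1≤n : 1 ≤ n) (coloopless : CoLoopless Dh) where
  open Algorithm Dh
  open Pipes n R̂ P̂ using (nextCol; trace)

  suc+∸ : ∀ {c} → c ≤ n → suc c + (n ∸ c) ≡ suc n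
  suc+∸ c≤n = cong suc (m+[n∸m]≡n c≤n)

  nextCol-just : ∀ {c c′} → c ≤ n → nextCol c ≡ just c′ →
    c < c′ × c′ ≤ n × R̂ c′ ≡ false × (∀ j → c < j → j < c′ → R̂ j ≢ false)
  nextCol-just {c} {c′} c≤n eq with firstFrom-just (suc c) (n ∸ c) _ eq
  ... | c<c′ , c′<end , c′col , gap =
    c<c′ , ≤-pred (subst (c′ <_) (suc+∸ c≤n) c′<end) , not-injective c′col ,
    λ j c<j j<c′ → not≡false⇒≢false (gap j c<j j<c′)

  nextCol-nothing : ∀ {c} → c ≤ n → nextCol c ≡ nothing → ∀ j → c < j → j ≤ n → R̂ j ≢ false
  nextCol-nothing {c} c≤n eq j c<j j≤n =
    not≡false⇒≢false (firstFrom-nothing (suc c) (n ∸ c) eq j c<j (subst (j <_) (sym (suc+∸ c≤n)) (s≤s j≤n)))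

  FirstPlusInRow1From : ℕ → ℕ → Set
  FirstPlusInRow1From c v = c ≤ v × v ≤ n × R̂ v ≡ false × P̂ 1 v ≡ true ×
    (∀ j → c ≤ j → j < v → R̂ j ≡ false → P̂ 1 j ≡ false)

  firstPlus-extend : ∀ {c c′ v} → c ≤ c′ → (∀ j → c ≤ j → j < c′ → R̂ j ≡ false → P̂ 1 j ≡ false) →
    FirstPlusInRow1From c′ v → FirstPlusInRow1From c v
  firstPlus-extend {c} {c′} {v} c≤c′ gap (c′≤v , v≤n , vcol , pv , before) =
    ≤-trans c≤c′ c′≤v , v≤n , vcol , pv , before′
    where
    before′ : ∀ j → c ≤ j → j < v → R̂ j ≡ false → P̂ 1 j ≡ false
    before′ j c≤j j<v jcol with c′ ≤? j
    ... | yes c′≤j = before j c′≤j j<v jcol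
    ... | no c′≰j = gap j c≤j (≰⇒> c′≰j) jcol

  -- Row 1 is the top row, so the pipe leaves the diagram at its first elbow.
  trace-row1 : ∀ f c → c ≤ n → R̂ c ≡ false → n ∸ c < f →
    ∃[ j ] (c ≤ j × j ≤ n × R̂ j ≡ false × P̂ 1 j ≡ true) →
    FirstPlusInRow1From c (trace f goLeft 1 c)
  trace-row1 (suc f) c c≤n ccol fuel (j , c≤j , j≤n , jcol , pj) with P̂ 1 c in pc
  ... | true = ≤-refl , c≤n , ccol , pc , λ j′ c≤j′ j′<c _ → ⊥-elim (<⇒≱ j′<c c≤j′)
  ... | false with nextCol c in next
  ...   | nothing = ⊥-elim (nextCol-nothing c≤n next j c<j j≤n jcol)
    where
    c<j : c < j
    c<j = ≤∧≢⇒< c≤j (λ { refl → not-¬ pj pc })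
  ...   | just c′ with nextCol-just c≤n next
  ...     | c<c′ , c′≤n , c′col , gap =
    firstPlus-extend (<⇒≤ c<c′) noPlus
      (trace-row1 f c′ c′≤n c′col (<-≤-trans (∸-monoʳ-< c<c′ c′≤n) (≤-pred fuel)) (j , c′≤j , j≤n , jcol , pj))
    where
    noPlus : ∀ j′ → c ≤ j′ → j′ < c′ → R̂ j′ ≡ false → P̂ 1 j′ ≡ false
    noPlus j′ c≤j′ j′<c′ j′col with c ≟ j′
    ... | yes refl = pc
    ... | no c≢j′ = ⊥-elim (gap j′ (≤∧≢⇒< c≤j′ c≢j′) j′<c′ j′col)
    c′≤j : c′ ≤ j
    c′≤j with c′ ≤? j
    ... | yes c′≤j = c′≤j
    ... | no c′≰j = ⊥-elim (not-¬ pj (noPlus j c≤j (≰⇒> c′≰j) jcol))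

  aₙ-of-column : R̂ 1 ≡ false → aₙ ≡ 1
  aₙ-of-column r1 rewrite r1 = refl

  aₙ-of-row : R̂ 1 ≡ true → FirstPlusInRow1From 2 aₙ
  aₙ-of-row r1 with coloopless 1 ≤-refl 1≤n r1
  ... | j , j≤n , p1j with plusAt-elim {R̂} {P̂} p1j
  ...   | (_ , jcol , 1<j) , pj rewrite r1 with nextCol 1 in next
  ...     | nothing = ⊥-elim (nextCol-nothing 1≤n next j 1<j j≤n jcol)
  ...     | just c with nextCol-just 1≤n next
  ...       | 1<c , c≤n , ccol , gap =
    firstPlus-extend 1<c (λ j′ 1<j′ j′<c j′col → ⊥-elim (gap j′ 1<j′ j′<c j′col))
      (trace-row1 (2 * n + 2) c c≤n ccol fuel (j , c≤j , j≤n , jcol , pj))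
    where
    fuel : n ∸ c < 2 * n + 2
    fuel = ≤-<-trans (m∸n≤m n c) (≤-<-trans (m≤m+n n (n + 0)) (m<m+n (2 * n) (s≤s z≤n)))
    c≤j : c ≤ j
    c≤j with c ≤? j
    ... | yes c≤j = c≤j
    ... | no c≰j = ⊥-elim (gap j 1<j (≰⇒> c≰j) jcol)

  aₙ-cases : (R̂ 1 ≡ true × FirstPlusInRow1From 2 aₙ) ⊎ (R̂ 1 ≡ false × aₙ ≡ 1)
  aₙ-cases = byRow1 (R̂ 1) refl
    where
    byRow1 : ∀ b → R̂ 1 ≡ b → (R̂ 1 ≡ true × FirstPlusInRow1From 2 aₙ) ⊎ (R̂ 1 ≡ false × aₙ ≡ 1)
    byRow1 true  r1 = inj₁ (r1 , aₙ-of-row r1)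
    byRow1 false r1 = inj₂ (r1 , aₙ-of-column r1)

  aₙ-column : R̂ aₙ ≡ false
  aₙ-column with aₙ-cases
  ... | inj₁ (_ , _ , _ , aₙcol , _) = aₙcol
  ... | inj₂ (r1 , aₙ≡1) = subst (λ a → R̂ a ≡ false) (sym aₙ≡1) r1

  1≤aₙ : 1 ≤ aₙ
  1≤aₙ with aₙ-cases
  ... | inj₁ (_ , 1<aₙ , _) = <⇒≤ 1<aₙ
  ... | inj₂ (_ , aₙ≡1) = ≤-reflexive (sym aₙ≡1)

  aₙ≤n : aₙ ≤ n
  aₙ≤n with aₙ-cases
  ... | inj₁ (_ , _ , aₙ≤n′ , _) = aₙ≤n′
  ... | inj₂ (_ , aₙ≡1) = subst (_≤ n) (sym aₙ≡1) 1≤n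

  row1-of-aₙ>1 : 1 < aₙ → R̂ 1 ≡ true
  row1-of-aₙ>1 1<aₙ with aₙ-cases
  ... | inj₁ (r1 , _) = r1
  ... | inj₂ (_ , aₙ≡1) = ⊥-elim (<-irrefl (sym aₙ≡1) 1<aₙ)

  row1-plus-aₙ : R̂ 1 ≡ true → plusAt R̂ P̂ 1 aₙ ≡ true
  row1-plus-aₙ r1 with aₙ-of-row r1
  ... | 1<aₙ , _ , aₙcol , p , _ = trans (plusAt-box {R̂} {P̂} r1 aₙcol 1<aₙ) p

  row≢aₙ : ∀ {x} → R̂ x ≡ true → x ≢ aₙ
  row≢aₙ rx refl = not-¬ rx aₙ-column

  rowD-row : ∀ {x} → R̂ x ≡ true → rowD x ≡ true
  rowD-row rx rewrite rx = refl

  rowD-nonRow : ∀ {x} → R̂ x ≡ false → x ≢ aₙ → rowD x ≡ false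
  rowD-nonRow rx x≢aₙ rewrite rx = ≢⇒≡ᵇ≡false x≢aₙ

  rowD-aₙ : rowD aₙ ≡ true
  rowD-aₙ = ∨-introʳ (≡⇒≡ᵇ≡true {aₙ} refl)

  W-spec : ∀ r → r ≤ n → (rowD (W r) ≡ true ⊎ W r ≡ suc n) × (∀ b → r < b → b < W r → b ≤ n → rowD b ≡ false)
  W-spec r r≤n with firstFrom rowD (suc r) (n ∸ r) in next
  ... | just w = let (_ , _ , rw , gap) = firstFrom-just (suc r) (n ∸ r) w next in
                 inj₁ rw , λ b r<b b<w _ → gap b r<b b<w
  ... | nothing = inj₂ refl , λ b r<b _ b≤n →
    firstFrom-nothing (suc r) (n ∸ r) next b r<b (subst (b <_) (sym (suc+∸ r≤n)) (s≤s b≤n))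

  leftmostPlus : ℕ → ℕ
  leftmostPlus x = fromMaybe 0 (lastIn (plusAt R̂ P̂ x) n)

  module _ {x : ℕ} (rx : R̂ x ≡ true) (1≤x : 1 ≤ x) (x≤n : x ≤ n) where

    leftmostPlus-spec : lastIn (plusAt R̂ P̂ x) n ≡ just (leftmostPlus x) ×
      plusAt R̂ P̂ x (leftmostPlus x) ≡ true × leftmostPlus x ≤ n ×
      (∀ j → leftmostPlus x < j → j ≤ n → plusAt R̂ P̂ x j ≡ false)
    leftmostPlus-spec with coloopless x 1≤x x≤n rx
    ... | j , j≤n , pxj with lastIn (plusAt R̂ P̂ x) n in last
    ...   | just L = let (_ , L≤n , pL , left) = lastIn-just n L last in refl , pL , L≤n , left
    ...   | nothing = ⊥-elim (not-¬ pxj (lastIn-nothing n last j 1≤j j≤n))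
      where
      1≤j : 1 ≤ j
      1≤j = ≤-trans 1≤x (<⇒≤ (plusAt-< {R̂} {P̂} pxj))

    leftmostPlus-plus : plusAt R̂ P̂ x (leftmostPlus x) ≡ true
    leftmostPlus-plus = proj₁ (proj₂ leftmostPlus-spec)

    leftmostPlus≤n : leftmostPlus x ≤ n
    leftmostPlus≤n = proj₁ (proj₂ (proj₂ leftmostPlus-spec))

    leftmostPlus-leftmost : ∀ j → leftmostPlus x < j → j ≤ n → plusAt R̂ P̂ x j ≡ false
    leftmostPlus-leftmost = proj₂ (proj₂ (proj₂ leftmostPlus-spec))

    <leftmostPlus : x < leftmostPlus x
    <leftmostPlus = plusAt-< {R̂} {P̂} leftmostPlus-plus

    ltL-row : ∀ ℓ → ltL x ℓ ≡ (ℓ <ᵇ leftmostPlus x)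
    ltL-row ℓ = cong (maybe (ℓ <ᵇ_) true)
      (trans (cong (λ b → if b then nothing else lastIn (plusAt R̂ P̂ x) n) (≢⇒≡ᵇ≡false (row≢aₙ rx)))
             (proj₁ leftmostPlus-spec))

    plusLeft-row : ∀ ℓ → plusLeft x ℓ ≡ (ℓ <ᵇ leftmostPlus x)
    plusLeft-row ℓ with leftmostPlus-spec | ℓ <ᵇ leftmostPlus x in ℓ<L
    ... | _ , pL , L≤n , _ | true =
      anyTo≡true n (leftmostPlus x) (≤-trans 1≤x (<⇒≤ <leftmostPlus)) L≤n (cong₂ _∧_ ℓ<L pL)
    ... | _ , _ , _ , left | false with plusLeft x ℓ in plus
    ...   | false = refl
    ...   | true with anyTo-witness n plus
    ...     | j , _ , j≤n , h =
      ⊥-elim (not-¬ (∧-conicalʳ (ℓ <ᵇ j) _ h)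
                    (left j (≤-<-trans (<ᵇ≡false⇒≥ ℓ<L) (<ᵇ≡true⇒< (∧-conicalˡ (ℓ <ᵇ j) _ h))) j≤n))

  typeII⇒<aₙ : ∀ {x} → typeII x ≡ true → x < aₙ
  typeII⇒<aₙ {x} type = plusAt-< {R̂} {P̂} (∧-conicalʳ (R̂ x) _ type)

  charge : ℕ → ℕ
  charge x = if typeII x then aₙ else leftmostPlus x

  charge-spec : ∀ {x} → R̂ x ≡ true → 1 ≤ x → x ≤ n → R̂ (charge x) ≡ false × x < charge x × charge x ≤ n
  charge-spec {x} rx 1≤x x≤n with typeII x in type
  ... | true  = aₙ-column , typeII⇒<aₙ type , aₙ≤n
  ... | false = plusAt-column {R̂} {P̂} (leftmostPlus-plus rx 1≤x x≤n) ,
                <leftmostPlus rx 1≤x x≤n , leftmostPlus≤n rx 1≤x x≤n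

  charge-typeII : ∀ {x} → typeII x ≡ true → charge x ≡ aₙ
  charge-typeII {x} type = cong (λ b → if b then aₙ else leftmostPlus x) type

  charge-notII : ∀ {x} → typeII x ≡ false → charge x ≡ leftmostPlus x
  charge-notII {x} notII = cong (λ b → if b then aₙ else leftmostPlus x) notII

  chargedTo : ℕ → ℕ → Bool
  chargedTo x ℓ = R̂ x ∧ (charge x ≡ᵇ ℓ)

  chargedTo-row : ∀ {x ℓ} → R̂ x ≡ true → chargedTo x ℓ ≡ (charge x ≡ᵇ ℓ)
  chargedTo-row {x} {ℓ} rx = cong (_∧ (charge x ≡ᵇ ℓ)) rx

  chargedTo-nonRow : ∀ {x ℓ} → R̂ x ≡ false → chargedTo x ℓ ≡ false
  chargedTo-nonRow {x} {ℓ} rx = cong (_∧ (charge x ≡ᵇ ℓ)) rx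

  module _ {x : ℕ} (rx : R̂ x ≡ true) (1≤x : 1 ≤ x) (x<aₙ : x < aₙ) (notII : typeII x ≡ false) where

    private
      row1 : R̂ 1 ≡ true
      row1 = row1-of-aₙ>1 (≤-<-trans 1≤x x<aₙ)

      noPlus-aₙ : plusAt R̂ P̂ x aₙ ≡ false
      noPlus-aₙ = trans (sym (cong (_∧ plusAt R̂ P̂ x aₙ) rx)) notII

      1<x : 1 < x
      1<x = ≤∧≢⇒< 1≤x (λ { refl → not-¬ (row1-plus-aₙ row1) noPlus-aₙ })

      x≤n : x ≤ n
      x≤n = <⇒≤ (<-≤-trans x<aₙ aₙ≤n)

    -- Row 1 has a + at aₙ, so the Le-property forbids a + to the left of the 0 at (x, aₙ).
    noPlus-leftOf-aₙ : ∀ j → aₙ < j → j ≤ n → plusAt R̂ P̂ x j ≡ false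
    noPlus-leftOf-aₙ j aₙ<j j≤n with plusAt R̂ P̂ x j in pxj
    ... | false = refl
    ... | true  = ⊥-elim (le Dh x aₙ 1 j ≤-refl j≤n zero-aₙ 1<x (row1-plus-aₙ row1) aₙ<j pxj)
      where
      zero-aₙ : zeroAt R̂ P̂ x aₙ ≡ true
      zero-aₙ = trans (zeroAt-box {R̂} {P̂} rx aₙ-column x<aₙ)
                      (cong not (trans (sym (plusAt-box {R̂} {P̂} rx aₙ-column x<aₙ)) noPlus-aₙ))

    leftmostPlus-<aₙ : leftmostPlus x < aₙ
    leftmostPlus-<aₙ with <-cmp (leftmostPlus x) aₙ
    ... | tri< L<aₙ _ _ = L<aₙ
    ... | tri≈ _ L≡aₙ _ = ⊥-elim (not-¬ (trans (cong (plusAt R̂ P̂ x) (sym L≡aₙ)) (leftmostPlus-plus rx 1≤x x≤n)) noPlus-aₙ)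
    ... | tri> _ _ aₙ<L = ⊥-elim (not-¬ (leftmostPlus-plus rx 1≤x x≤n)
                                         (noPlus-leftOf-aₙ (leftmostPlus x) aₙ<L (leftmostPlus≤n rx 1≤x x≤n)))

  module Column (ℓ : ℕ) (1≤ℓ : 1 ≤ ℓ) (ℓ≤n : ℓ ≤ n) (ℓcol : R̂ ℓ ≡ false) (ℓ≢aₙ : ℓ ≢ aₙ) where

    inD inD̂ charged : ℕ → Bool
    inD x = plusAt rowD plusD x ℓ
    inD̂ x = plusAt R̂ P̂ x ℓ
    charged x = chargedTo x ℓ

    restricted : ℕ → Bool
    restricted b = zeroAt R̂ P̂ b ℓ ∧ plusLeft b ℓ

    noRestrictedBelow : ℕ → Bool
    noRestrictedBelow y = condII y ℓ ∨ condIII y ℓ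

    NoRestrictedBelow : ℕ → Set
    NoRestrictedBelow y = ∀ b → y < b → restricted b ≡ true → ⊥

    restricted-< : ∀ {b} → restricted b ≡ true → b < ℓ
    restricted-< rb = proj₂ (proj₂ (proj₁ (zeroAt-elim {R̂} {P̂} (∧-conicalˡ _ _ rb))))

    restricted⇒¬unrestricted : ∀ {b} → restricted b ≡ true → unrestrictedZero b ℓ ≡ true → ⊥
    restricted⇒¬unrestricted {b} rb ub =
      not-¬ (∧-conicalʳ (zeroAt R̂ P̂ b ℓ) _ rb) (not-injective (∧-conicalʳ (zeroAt R̂ P̂ b ℓ) _ ub))

    unrestricted-of-row : ∀ {b} → R̂ b ≡ true → b < ℓ → inD̂ b ≡ false → (restricted b ≡ true → ⊥) →
      unrestrictedZero b ℓ ≡ true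
    unrestricted-of-row {b} rb b<ℓ no+ notR with zeroAt R̂ P̂ b ℓ in z | plusLeft b ℓ in left
    ... | true  | false = refl
    ... | true  | true  = ⊥-elim (notR refl)
    ... | false | _     = ⊥-elim (not-¬ (trans (sym (zeroAt-box {R̂} {P̂} rb ℓcol b<ℓ)) z)
                                        (cong not (trans (sym (plusAt-box {R̂} {P̂} rb ℓcol b<ℓ)) no+)))

    condIII-sound : ∀ y → condIII y ℓ ≡ true → NoRestrictedBelow y
    condIII-sound y iii b y<b rb with zeroAt-elim {R̂} {P̂} (∧-conicalˡ _ _ rb)
    ... | (rowb , _ , b<ℓ) , _ = restricted⇒¬unrestricted rb (implies-elim
      (allTo-elim n iii b (≤-trans (s≤s z≤n) y<b) (<⇒≤ (<-≤-trans b<ℓ ℓ≤n)))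
      (∧³-intro rowb (<⇒<ᵇ≡true y<b) (boxExists-intro {R̂} rowb ℓcol b<ℓ)))

    -- A restricted 0 below the + of (ii) would violate the Le-property.
    condII-sound : ∀ y → condII y ℓ ≡ true → NoRestrictedBelow y
    condII-sound y ii b y<b rb with anyTo-witness n ii | zeroAt-elim {R̂} {P̂} (∧-conicalˡ _ _ rb)
    ... | b′ , 1≤b′ , _ , hb′ | (rowb , _ , b<ℓ) , zero-b with <-cmp b b′
    ...   | tri< b<b′ _ _ = restricted⇒¬unrestricted rb (implies-elim
      (allTo-elim n (∧-conicalʳ (inD̂ b′) _ (∧-conicalʳ (y <ᵇ b′) _ hb′)) b (≤-trans (s≤s z≤n) y<b) (<⇒≤ (<-≤-trans b<ℓ ℓ≤n)))
      (∧³-intro rowb (<⇒<ᵇ≡true y<b) (<⇒<ᵇ≡true b<b′)))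
    ...   | tri≈ _ refl _ = not-¬ (proj₂ (plusAt-elim {R̂} {P̂} plusb′)) zero-b
      where
      plusb′ : inD̂ b ≡ true
      plusb′ = ∧-conicalˡ _ _ (∧-conicalʳ (y <ᵇ b) _ hb′)
    ...   | tri> _ _ b′<b with anyTo-witness n (∧-conicalʳ (zeroAt R̂ P̂ b ℓ) _ rb)
    ...     | j , _ , j≤n , hj = le Dh b ℓ b′ j 1≤b′ j≤n (∧-conicalˡ _ _ rb) b′<b
      (∧-conicalˡ _ _ (∧-conicalʳ (y <ᵇ b′) _ hb′)) (<ᵇ≡true⇒< (∧-conicalˡ (ℓ <ᵇ j) _ hj)) (∧-conicalʳ (ℓ <ᵇ j) _ hj)

    noRestrictedBelow-sound : ∀ y → noRestrictedBelow y ≡ true → NoRestrictedBelow y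
    noRestrictedBelow-sound y h with ∨≡true⇒ {condII y ℓ} h
    ... | inj₁ ii  = condII-sound y ii
    ... | inj₂ iii = condIII-sound y iii

    condIII-vacuous : ∀ y → (∀ b → R̂ b ≡ true → y < b → b < ℓ → ⊥) → condIII y ℓ ≡ true
    condIII-vacuous y noRow = allTo≡true n λ b _ _ →
      implies-intro³ (R̂ b) (y <ᵇ b) (boxExists R̂ b ℓ)
        (λ rb y<b box → ⊥-elim (noRow b rb (<ᵇ≡true⇒< y<b) (proj₂ (proj₂ (boxExists-elim {R̂} box)))))

    allBelow-extend : ∀ (X : ℕ → Bool) y →
      (R̂ (suc y) ≡ true → X (suc y) ≡ true → unrestrictedZero (suc y) ℓ ≡ true) →
      allTo (λ b → not (R̂ b ∧ (suc y <ᵇ b) ∧ X b) ∨ unrestrictedZero b ℓ) n ≡ true →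
      allTo (λ b → not (R̂ b ∧ (y <ᵇ b) ∧ X b) ∨ unrestrictedZero b ℓ) n ≡ true
    allBelow-extend X y top rest = allTo≡true n entry
      where
      entry : ∀ b → 1 ≤ b → b ≤ n → not (R̂ b ∧ (y <ᵇ b) ∧ X b) ∨ unrestrictedZero b ℓ ≡ true
      entry b 1≤b b≤n with b ≟ suc y
      ... | yes refl = implies-intro³ (R̂ (suc y)) (y <ᵇ suc y) (X (suc y)) (λ r _ x → top r x)
      ... | no b≢1+y = trans (cong (λ c → not (R̂ b ∧ c ∧ X b) ∨ unrestrictedZero b ℓ) (<ᵇ-suc b≢1+y))
                             (allTo-elim n rest b 1≤b b≤n)

    noRestrictedBelow-plus : ∀ y → inD̂ (suc y) ≡ true → noRestrictedBelow y ≡ true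
    noRestrictedBelow-plus y plus = ∨-introˡ (anyTo≡true n (suc y) (s≤s z≤n) 1+y≤n
      (∧³-intro (<⇒<ᵇ≡true (n<1+n y)) plus (allTo≡true n λ b _ _ →
        implies-intro³ (R̂ b) (y <ᵇ b) (b <ᵇ suc y)
          (λ _ y<b b<1+y → ⊥-elim (<⇒≱ (<ᵇ≡true⇒< {y} {b} y<b) (≤-pred (<ᵇ≡true⇒< {b} b<1+y)))))))
      where
      1+y≤n : suc y ≤ n
      1+y≤n = <⇒≤ (<-≤-trans (plusAt-< {R̂} {P̂} plus) ℓ≤n)

    noRestrictedBelow-extend : ∀ y → NoRestrictedBelow y → inD̂ (suc y) ≡ false →
      noRestrictedBelow (suc y) ≡ true → noRestrictedBelow y ≡ true
    noRestrictedBelow-extend y noR no+ h with ∨≡true⇒ {condII (suc y) ℓ} h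
    ... | inj₂ iii = ∨-introʳ (allBelow-extend (λ b → boxExists R̂ b ℓ) y
                       (λ r box → top r (proj₂ (proj₂ (boxExists-elim {R̂} box)))) iii)
      where
      top : R̂ (suc y) ≡ true → suc y < ℓ → unrestrictedZero (suc y) ℓ ≡ true
      top r 1+y<ℓ = unrestricted-of-row r 1+y<ℓ no+ (noR (suc y) (n<1+n y))
    ... | inj₁ ii with anyTo-witness n ii
    ...   | b′ , 1≤b′ , b′≤n , hb′ = ∨-introˡ (anyTo≡true n b′ 1≤b′ b′≤n
      (∧³-intro (<⇒<ᵇ≡true (<-trans (n<1+n y) 1+y<b′)) plusb′
        (allBelow-extend (_<ᵇ b′) y (λ r 1+y<ᵇb′ → top r (<-trans (<ᵇ≡true⇒< 1+y<ᵇb′) b′<ℓ))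
                         (∧-conicalʳ (inD̂ b′) _ (∧-conicalʳ (suc y <ᵇ b′) _ hb′)))))
      where
      top : R̂ (suc y) ≡ true → suc y < ℓ → unrestrictedZero (suc y) ℓ ≡ true
      top r 1+y<ℓ = unrestricted-of-row r 1+y<ℓ no+ (noR (suc y) (n<1+n y))
      1+y<b′ : suc y < b′
      1+y<b′ = <ᵇ≡true⇒< (∧-conicalˡ _ _ hb′)
      plusb′ : inD̂ b′ ≡ true
      plusb′ = ∧-conicalˡ _ _ (∧-conicalʳ (suc y <ᵇ b′) _ hb′)
      b′<ℓ : b′ < ℓ
      b′<ℓ = plusAt-< {R̂} {P̂} plusb′

    noRestrictedBelow-complete : ∀ y → NoRestrictedBelow y → noRestrictedBelow y ≡ true
    noRestrictedBelow-complete y = descend ℓ y (m≤n+m ℓ y)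
      where
      descend : ∀ d y → ℓ ≤ y + d → NoRestrictedBelow y → noRestrictedBelow y ≡ true
      descend d y ℓ≤y+d noR with ℓ ≤? y
      ... | yes ℓ≤y = ∨-introʳ (condIII-vacuous y (λ b _ y<b b<ℓ → <⇒≱ (<-trans y<b b<ℓ) ℓ≤y))
      descend zero y ℓ≤y+0 noR | no ℓ≰y = ⊥-elim (ℓ≰y (subst (ℓ ≤_) (+-identityʳ y) ℓ≤y+0))
      descend (suc d) y ℓ≤y+1+d noR | no ℓ≰y with inD̂ (suc y) in plus
      ... | true  = noRestrictedBelow-plus y plus
      ... | false = noRestrictedBelow-extend y noR plus
        (descend d (suc y) (subst (ℓ ≤_) (+-suc y d) ℓ≤y+1+d) (λ b 1+y<b → noR b (<-trans (n<1+n y) 1+y<b)))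

    noRestrictedBelow-≥ : ∀ y → ℓ ≤ suc y → noRestrictedBelow y ≡ true
    noRestrictedBelow-≥ y ℓ≤1+y = noRestrictedBelow-complete y
      (λ b y<b rb → <⇒≱ (restricted-< rb) (≤-trans ℓ≤1+y y<b))

    noRestrictedBelow-suc : ∀ y → noRestrictedBelow y ≡ (if restricted (suc y) then false else noRestrictedBelow (suc y))
    noRestrictedBelow-suc y with restricted (suc y) in r | noRestrictedBelow y in t | noRestrictedBelow (suc y) in t′
    ... | true  | false | _     = refl
    ... | true  | true  | _     = ⊥-elim (noRestrictedBelow-sound y t (suc y) (n<1+n y) r)
    ... | false | true  | true  = refl
    ... | false | false | false = refl
    ... | false | true  | false = ⊥-elim (not-¬ (noRestrictedBelow-complete (suc y)
            (λ b 1+y<b → noRestrictedBelow-sound y t b (<-trans (n<1+n y) 1+y<b))) t′)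
    ... | false | false | true  = ⊥-elim (not-¬ (noRestrictedBelow-complete y noR) t)
      where
      noR : NoRestrictedBelow y
      noR b y<b rb with b ≟ suc y
      ... | yes refl = not-¬ rb r
      ... | no b≢1+y = noRestrictedBelow-sound (suc y) t′ b (≤∧≢⇒< y<b (λ eq → b≢1+y (sym eq))) rb

    rowD-ℓ : rowD ℓ ≡ false
    rowD-ℓ = rowD-nonRow ℓcol ℓ≢aₙ

    -- ℓ is a column of D, so ℓ ≠ W r; if ℓ < W r no row of D̂ lies in (r, ℓ) and (iii) holds vacuously.
    ruleI-column : ∀ r → rowD r ≡ true → r < ℓ → ruleI r ℓ ≡ ltL r ℓ ∧ (condI r ℓ ∨ noRestrictedBelow r)
    ruleI-column r rowr r<ℓ with W-spec r (<⇒≤ (<-≤-trans r<ℓ ℓ≤n))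
    ... | W-end , gap with ltL r ℓ
    ...   | false = refl
    ...   | true with ℓ <ᵇ W r in ℓ<W
    ...     | true = sym (∨-introʳ {condI r ℓ} (∨-introʳ {condII r ℓ} (condIII-vacuous r
                  (λ b rb r<b b<ℓ → not-¬ (rowD-row rb) (gap b r<b (<-trans b<ℓ (<ᵇ≡true⇒< ℓ<W)) (<⇒≤ (<-≤-trans b<ℓ ℓ≤n)))))))
    ...     | false with W r <ᵇ ℓ in W<ℓ
    ...       | true  = refl
    ...       | false = ⊥-elim (ℓ≢W (≤-antisym (<ᵇ≡false⇒≥ W<ℓ) (<ᵇ≡false⇒≥ ℓ<W)))
      where
      ℓ≢W : ℓ ≢ W r
      ℓ≢W ℓ≡W = [ (λ rowW → not-¬ (trans (cong rowD ℓ≡W) rowW) rowD-ℓ)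
                , (λ W≡1+n → <-irrefl refl (subst (_≤ n) (trans ℓ≡W W≡1+n) ℓ≤n)) ]′ W-end

    plusD-ruleI : ∀ x → (typeII x ≡ true → ℓ < aₙ) → plusD x ℓ ≡ ruleI x ℓ
    plusD-ruleI x h with typeII x in type
    ... | true  = cong (λ b → if b then ruleI x ℓ else plusAt R̂ P̂ x ℓ) (<⇒<ᵇ≡true (h refl))
    ... | false = refl

    plusD-copy : ∀ x → typeII x ≡ true → aₙ < ℓ → plusD x ℓ ≡ inD̂ x
    plusD-copy x type aₙ<ℓ rewrite type | ≥⇒<ᵇ≡false (<⇒≤ aₙ<ℓ) = refl

    charge≡ᵇℓ : ∀ {x} → R̂ x ≡ true → 1 ≤ x → x ≤ n → x < ℓ → (typeII x ≡ true → ℓ < aₙ) →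
      (charge x ≡ᵇ ℓ) ≡ P̂ x ℓ ∧ not (plusLeft x ℓ)
    charge≡ᵇℓ {x} rx 1≤x x≤n x<ℓ h with typeII x in type
    ... | true = begin
      aₙ ≡ᵇ ℓ                        ≡⟨ ≢⇒≡ᵇ≡false (≢-sym ℓ≢aₙ) ⟩
      false                          ≡⟨ ∧-zeroʳ (P̂ x ℓ) ⟨
      P̂ x ℓ ∧ false                  ≡⟨ cong (λ b → P̂ x ℓ ∧ not b) plusLeft-aₙ ⟨
      P̂ x ℓ ∧ not (plusLeft x ℓ)     ∎
      where
      open ≡-Reasoning
      plusLeft-aₙ : plusLeft x ℓ ≡ true
      plusLeft-aₙ = anyTo≡true n aₙ 1≤aₙ aₙ≤n (cong₂ _∧_ (<⇒<ᵇ≡true (h refl)) (∧-conicalʳ (R̂ x) _ type))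
    ... | false = trans (compare (<-cmp (leftmostPlus x) ℓ)) (cong (λ b → P̂ x ℓ ∧ not b) (sym (plusLeft-row rx 1≤x x≤n ℓ)))
      where
      L : ℕ
      L = leftmostPlus x
      P̂≡ : P̂ x ℓ ≡ inD̂ x
      P̂≡ = sym (plusAt-box {R̂} {P̂} rx ℓcol x<ℓ)
      compare : Tri (L < ℓ) (L ≡ ℓ) (ℓ < L) → (L ≡ᵇ ℓ) ≡ P̂ x ℓ ∧ not (ℓ <ᵇ L)
      compare (tri< L<ℓ _ _) = trans (≢⇒≡ᵇ≡false (<⇒≢ L<ℓ))
        (sym (cong₂ (λ u v → u ∧ not v) (trans P̂≡ (leftmostPlus-leftmost rx 1≤x x≤n ℓ L<ℓ ℓ≤n))
                                        (≥⇒<ᵇ≡false (<⇒≤ L<ℓ))))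
      compare (tri≈ _ L≡ℓ _) = trans (≡⇒≡ᵇ≡true L≡ℓ)
        (sym (cong₂ (λ u v → u ∧ not v) (trans P̂≡ (trans (cong (plusAt R̂ P̂ x) (sym L≡ℓ)) (leftmostPlus-plus rx 1≤x x≤n)))
                                        (≥⇒<ᵇ≡false (≤-reflexive L≡ℓ))))
      compare (tri> _ _ ℓ<L) = trans (≢⇒≡ᵇ≡false (λ L≡ℓ → <⇒≢ ℓ<L (sym L≡ℓ)))
        (sym (trans (cong (λ v → P̂ x ℓ ∧ not v) (<⇒<ᵇ≡true ℓ<L)) (∧-zeroʳ (P̂ x ℓ))))

    UsesRuleI : ℕ → Set
    UsesRuleI x = x < ℓ → x ≢ aₙ × (typeII x ≡ true → ℓ < aₙ)

    RowStep : ℕ → Set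
    RowStep m = toℕ (inD (suc m)) + toℕ (charged (suc m)) + toℕ (noRestrictedBelow m)
              ≡ toℕ (inD̂ (suc m)) + toℕ (noRestrictedBelow (suc m))

    charged-≥ : ∀ {x} → x ≤ n → ℓ ≤ x → charged x ≡ false
    charged-≥ {x} x≤n ℓ≤x with true-or-false (R̂ x)
    ... | inj₂ r = chargedTo-nonRow r
    ... | inj₁ r = trans (chargedTo-row r)
      (≢⇒≡ᵇ≡false (λ c≡ℓ → <⇒≱ (proj₁ (proj₂ (charge-spec r (≤-trans 1≤ℓ ℓ≤x) x≤n))) (subst (_≤ x) (sym c≡ℓ) ℓ≤x)))

    rowStep-≥ : ∀ m → suc m ≤ n → ℓ ≤ suc m → RowStep m
    rowStep-≥ m 1+m≤n ℓ≤1+m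
      rewrite plusAt-≥ {rowD} {plusD} ℓ≤1+m | plusAt-≥ {R̂} {P̂} ℓ≤1+m | charged-≥ 1+m≤n ℓ≤1+m
            | noRestrictedBelow-≥ m ℓ≤1+m | noRestrictedBelow-≥ (suc m) (m≤n⇒m≤1+n ℓ≤1+m) = refl

    rowStep-nonRow : ∀ m → R̂ (suc m) ≡ false → suc m ≢ aₙ → RowStep m
    rowStep-nonRow m r x≢aₙ
      rewrite plusAt-nonRow {rowD} {plusD} {j = ℓ} (rowD-nonRow r x≢aₙ) | plusAt-nonRow {R̂} {P̂} {j = ℓ} r =
      cong₂ (λ c t → toℕ c + toℕ t) (chargedTo-nonRow r)
        (trans (noRestrictedBelow-suc m)
               (cong (λ b → if b ∧ plusLeft (suc m) ℓ then false else noRestrictedBelow (suc m)) (zeroAt-nonRow {R̂} {P̂} {j = ℓ} r)))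

    -- p: D̂ has + at (x, ℓ); l: row x has a + left of ℓ; t: no restricted 0 below row x.
    row-balance : ∀ p l t →
      toℕ (l ∧ (p ∨ t)) + toℕ (p ∧ not l) + toℕ (if not p ∧ l then false else t) ≡ toℕ p + toℕ t
    row-balance true  true  t     = refl
    row-balance true  false t     = refl
    row-balance false true  true  = refl
    row-balance false true  false = refl
    row-balance false false t     = refl

    rowStep-row : ∀ m → R̂ (suc m) ≡ true → suc m ≤ n → suc m < ℓ → (typeII (suc m) ≡ true → ℓ < aₙ) → RowStep m
    rowStep-row m r x≤n x<ℓ h = begin
      toℕ (inD x) + toℕ (charged x) + toℕ (noRestrictedBelow m)
        ≡⟨ cong₂ _+_ (cong₂ _+_ (cong toℕ inD≡) (cong toℕ charged≡)) (cong toℕ step≡) ⟩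
      toℕ (plusLeft x ℓ ∧ (P̂ x ℓ ∨ noRestrictedBelow x)) + toℕ (P̂ x ℓ ∧ not (plusLeft x ℓ))
        + toℕ (if not (P̂ x ℓ) ∧ plusLeft x ℓ then false else noRestrictedBelow x)
        ≡⟨ row-balance (P̂ x ℓ) (plusLeft x ℓ) (noRestrictedBelow x) ⟩
      toℕ (P̂ x ℓ) + toℕ (noRestrictedBelow x)
        ≡⟨ cong (λ b → toℕ b + toℕ (noRestrictedBelow x)) P̂≡ ⟩
      toℕ (inD̂ x) + toℕ (noRestrictedBelow x) ∎
      where
      open ≡-Reasoning
      x : ℕ
      x = suc m
      1≤x : 1 ≤ x
      1≤x = s≤s z≤n
      P̂≡ : P̂ x ℓ ≡ inD̂ x
      P̂≡ = sym (plusAt-box {R̂} {P̂} r ℓcol x<ℓ)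
      inD≡ : inD x ≡ plusLeft x ℓ ∧ (P̂ x ℓ ∨ noRestrictedBelow x)
      inD≡ = begin
        inD x                                                 ≡⟨ plusAt-box {rowD} {plusD} (rowD-row r) rowD-ℓ x<ℓ ⟩
        plusD x ℓ                                             ≡⟨ plusD-ruleI x h ⟩
        ruleI x ℓ                                             ≡⟨ ruleI-column x (rowD-row r) x<ℓ ⟩
        ltL x ℓ ∧ (condI x ℓ ∨ noRestrictedBelow x)          ≡⟨ cong₂ (λ u v → u ∧ (v ∨ noRestrictedBelow x))
                                                                  (trans (ltL-row r 1≤x x≤n ℓ) (sym (plusLeft-row r 1≤x x≤n ℓ))) (sym P̂≡) ⟩
        plusLeft x ℓ ∧ (P̂ x ℓ ∨ noRestrictedBelow x)         ∎
      charged≡ : charged x ≡ P̂ x ℓ ∧ not (plusLeft x ℓ)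
      charged≡ = trans (chargedTo-row r) (charge≡ᵇℓ r 1≤x x≤n x<ℓ h)
      step≡ : noRestrictedBelow m ≡ (if not (P̂ x ℓ) ∧ plusLeft x ℓ then false else noRestrictedBelow x)
      step≡ = trans (noRestrictedBelow-suc m)
        (cong (λ b → if b ∧ plusLeft x ℓ then false else noRestrictedBelow x) (zeroAt-box {R̂} {P̂} r ℓcol x<ℓ))

    rowStep : ∀ m → suc m ≤ n → UsesRuleI (suc m) → RowStep m
    rowStep m x≤n uses with ℓ ≤? suc m | true-or-false (R̂ (suc m))
    ... | yes ℓ≤x | _      = rowStep-≥ m x≤n ℓ≤x
    ... | no ℓ≰x  | inj₂ r = rowStep-nonRow m r (proj₁ (uses (≰⇒> ℓ≰x)))
    ... | no ℓ≰x  | inj₁ r = rowStep-row m r x≤n (≰⇒> ℓ≰x) (proj₂ (uses (≰⇒> ℓ≰x)))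

    private
      f g t : ℕ → ℕ
      f x = toℕ (inD x) + toℕ (charged x)
      g x = toℕ (inD̂ x)
      t y = toℕ (noRestrictedBelow y)

    column-identity-from : ∀ {e} p → p ≤ n → (∀ x → p < x → x ≤ n → UsesRuleI x) →
      sumTo f p + e ≡ sumTo g p + t p → e ≡ 0 → count inD n + count charged n ≡ count inD̂ n + 1
    column-identity-from p p≤n uses base refl = begin
      count inD n + count charged n       ≡⟨ cong₂ _+_ (count≡sumTo inD n) (count≡sumTo charged n) ⟩
      sumTo (toℕ ∘ inD) n + sumTo (toℕ ∘ charged) n ≡⟨ sumTo-+ (toℕ ∘ inD) (toℕ ∘ charged) n ⟨
      sumTo f n                           ≡⟨ +-identityʳ (sumTo f n) ⟨
      sumTo f n + 0
        ≡⟨ sumTo-telescope f g t n (λ m p≤m m<n → rowStep m m<n (uses (suc m) (s≤s p≤m) m<n)) base p≤n ⟩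
      sumTo g n + t n
        ≡⟨ cong₂ _+_ (sym (count≡sumTo inD̂ n)) (cong toℕ (noRestrictedBelow-≥ n (m≤n⇒m≤1+n ℓ≤n))) ⟩
      count inD̂ n + 1                     ∎
      where open ≡-Reasoning

    column-identity-leftOf-aₙ : ℓ < aₙ → count inD n + count charged n ≡ count inD̂ n + 1
    column-identity-leftOf-aₙ ℓ<aₙ = column-identity-from 0 z≤n uses refl (cong toℕ noRestricted-0)
      where
      row1 : R̂ 1 ≡ true
      row1 = row1-of-aₙ>1 (≤-<-trans 1≤ℓ ℓ<aₙ)
      1<ℓ : 1 < ℓ
      1<ℓ = ≤∧≢⇒< 1≤ℓ (λ { refl → not-¬ row1 ℓcol })
      -- Row 1 has its first + at aₙ > ℓ, so its 0 at (1, ℓ) is restricted.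
      restricted-1 : restricted 1 ≡ true
      restricted-1 = cong₂ _∧_
        (trans (zeroAt-box {R̂} {P̂} row1 ℓcol 1<ℓ) (cong not (proj₂ (proj₂ (proj₂ (proj₂ (aₙ-of-row row1)))) ℓ 1<ℓ ℓ<aₙ ℓcol)))
        (anyTo≡true n aₙ 1≤aₙ aₙ≤n (cong₂ _∧_ (<⇒<ᵇ≡true ℓ<aₙ) (row1-plus-aₙ row1)))
      noRestricted-0 : noRestrictedBelow 0 ≡ false
      noRestricted-0 = trans (noRestrictedBelow-suc 0) (cong (λ b → if b then false else noRestrictedBelow 1) restricted-1)
      uses : ∀ x → 0 < x → x ≤ n → UsesRuleI x
      uses x _ _ x<ℓ = (λ x≡aₙ → <-irrefl x≡aₙ (<-trans x<ℓ ℓ<aₙ)) , (λ _ → ℓ<aₙ)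

    module RightOfAₙ (aₙ<ℓ : aₙ < ℓ) where

      rowAbove-aₙ : ∀ x → 1 ≤ x → x < aₙ → f x ≡ g x
      rowAbove-aₙ x 1≤x x<aₙ with true-or-false (R̂ x)
      ... | inj₂ r rewrite plusAt-nonRow {rowD} {plusD} {j = ℓ} (rowD-nonRow r (<⇒≢ x<aₙ))
                         | plusAt-nonRow {R̂} {P̂} {j = ℓ} r | r = refl
      ... | inj₁ r with true-or-false (typeII x)
      ...   | inj₁ type = trans (cong₂ (λ u v → toℕ u + toℕ v)
                (trans (plusAt-box {rowD} {plusD} (rowD-row r) rowD-ℓ x<ℓ) (plusD-copy x type aₙ<ℓ))
                (trans (trans (chargedTo-row r) (cong (_≡ᵇ ℓ) (charge-typeII type)))
                       (≢⇒≡ᵇ≡false (≢-sym ℓ≢aₙ))))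
                (+-identityʳ (g x))
        where
        x<ℓ : x < ℓ
        x<ℓ = <-trans x<aₙ aₙ<ℓ
      ...   | inj₂ notII = trans (cong₂ (λ u v → toℕ u + toℕ v) inD≡ charged≡)
                                   (cong toℕ (sym (noPlus-leftOf-aₙ r 1≤x x<aₙ notII ℓ aₙ<ℓ ℓ≤n)))
        where
        x<ℓ : x < ℓ
        x<ℓ = <-trans x<aₙ aₙ<ℓ
        x≤n : x ≤ n
        x≤n = <⇒≤ (<-≤-trans x<aₙ aₙ≤n)
        L<ℓ : leftmostPlus x < ℓ
        L<ℓ = <-trans (leftmostPlus-<aₙ r 1≤x x<aₙ notII) aₙ<ℓ
        inD≡ : inD x ≡ false
        inD≡ = begin
          inD x                                       ≡⟨ plusAt-box {rowD} {plusD} (rowD-row r) rowD-ℓ x<ℓ ⟩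
          plusD x ℓ                                   ≡⟨ plusD-ruleI x (λ type → ⊥-elim (not-¬ type notII)) ⟩
          ruleI x ℓ                                   ≡⟨ ruleI-column x (rowD-row r) x<ℓ ⟩
          ltL x ℓ ∧ (condI x ℓ ∨ noRestrictedBelow x) ≡⟨ cong (_∧ (condI x ℓ ∨ noRestrictedBelow x))
                                                           (trans (ltL-row r 1≤x x≤n ℓ) (≥⇒<ᵇ≡false (<⇒≤ L<ℓ))) ⟩
          false                                       ∎
          where open ≡-Reasoning
        charged≡ : charged x ≡ false
        charged≡ = trans (trans (chargedTo-row r) (cong (_≡ᵇ ℓ) (charge-notII notII)))
                         (≢⇒≡ᵇ≡false (<⇒≢ L<ℓ))

      inD-aₙ : inD aₙ ≡ noRestrictedBelow aₙ
      inD-aₙ = begin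
        inD aₙ                                        ≡⟨ plusAt-box {rowD} {plusD} rowD-aₙ rowD-ℓ aₙ<ℓ ⟩
        plusD aₙ ℓ                                    ≡⟨ plusD-ruleI aₙ (λ type → ⊥-elim (not-¬ type (cong (_∧ plusAt R̂ P̂ aₙ aₙ) aₙ-column))) ⟩
        ruleI aₙ ℓ                                    ≡⟨ ruleI-column aₙ rowD-aₙ aₙ<ℓ ⟩
        ltL aₙ ℓ ∧ (condI aₙ ℓ ∨ noRestrictedBelow aₙ) ≡⟨ cong₂ (λ u v → u ∧ (v ∨ noRestrictedBelow aₙ)) ltL-aₙ
                                                             (plusAt-nonRow {R̂} {P̂} aₙ-column) ⟩
        noRestrictedBelow aₙ                          ∎
        where
        open ≡-Reasoning
        ltL-aₙ : ltL aₙ ℓ ≡ true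
        ltL-aₙ = cong (λ b → maybe (ℓ <ᵇ_) true (if b then nothing else lastIn (plusAt R̂ P̂ aₙ) n)) (≡⇒≡ᵇ≡true {aₙ} refl)

      f-aₙ : f aₙ ≡ t aₙ
      f-aₙ = trans (cong₂ (λ u v → toℕ u + toℕ v) inD-aₙ (chargedTo-nonRow aₙ-column)) (+-identityʳ (t aₙ))

      base : ∀ {a} → a ≡ aₙ → sumTo f a + 0 ≡ sumTo g a + t a
      base {zero} 0≡aₙ = ⊥-elim (<⇒≢ 1≤aₙ 0≡aₙ)
      base {suc m} a≡aₙ = begin
        f (suc m) + sumTo f m + 0          ≡⟨ +-identityʳ _ ⟩
        f (suc m) + sumTo f m              ≡⟨ cong₂ _+_ (subst (λ a → f a ≡ t a) (sym a≡aₙ) f-aₙ) (sumTo-cong m prefix) ⟩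
        t (suc m) + sumTo g m              ≡⟨ +-comm (t (suc m)) (sumTo g m) ⟩
        sumTo g m + t (suc m)              ≡⟨ cong (λ b → toℕ b + sumTo g m + t (suc m)) g-aₙ ⟨
        g (suc m) + sumTo g m + t (suc m)  ∎
        where
        open ≡-Reasoning
        g-aₙ : inD̂ (suc m) ≡ false
        g-aₙ = plusAt-nonRow {R̂} {P̂} (subst (λ a → R̂ a ≡ false) (sym a≡aₙ) aₙ-column)
        prefix : OnLabels (λ x → f x ≡ g x) m
        prefix x 1≤x x≤m = rowAbove-aₙ x 1≤x (subst (x <_) a≡aₙ (s≤s x≤m))

      column-identity : count inD n + count charged n ≡ count inD̂ n + 1
      column-identity = column-identity-from aₙ aₙ≤n uses (base refl) refl
        where
        uses : ∀ x → aₙ < x → x ≤ n → UsesRuleI x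
        uses x aₙ<x _ _ = (λ x≡aₙ → <-irrefl (sym x≡aₙ) aₙ<x)
                        , (λ type → ⊥-elim (<-asym aₙ<x (typeII⇒<aₙ type)))

    column-identity : count inD n + count charged n ≡ count inD̂ n + 1
    column-identity with <-cmp ℓ aₙ
    ... | tri< ℓ<aₙ _ _ = column-identity-leftOf-aₙ ℓ<aₙ
    ... | tri≈ _ ℓ≡aₙ _ = ⊥-elim (ℓ≢aₙ ℓ≡aₙ)
    ... | tri> _ _ aₙ<ℓ = RightOfAₙ.column-identity aₙ<ℓ

  plusesD plusesD̂ chargedRows : ℕ → ℕ
  plusesD ℓ = count (λ r → plusAt rowD plusD r ℓ) n
  plusesD̂ ℓ = count (λ r → plusAt R̂ P̂ r ℓ) n
  chargedRows ℓ = count (λ r → chargedTo r ℓ) n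

  charged-plus : ∀ {r ℓ} → 1 ≤ r → r ≤ n → ℓ ≢ aₙ → chargedTo r ℓ ≡ true → plusAt R̂ P̂ r ℓ ≡ true
  charged-plus {r} {ℓ} 1≤r r≤n ℓ≢aₙ h with true-or-false (typeII r)
  ... | inj₁ type = ⊥-elim (ℓ≢aₙ (trans (sym (≡ᵇ≡true⇒≡ (∧-conicalʳ (R̂ r) _ h))) (charge-typeII type)))
  ... | inj₂ notII = subst (λ j → plusAt R̂ P̂ r j ≡ true)
      (trans (sym (charge-notII notII)) (≡ᵇ≡true⇒≡ (∧-conicalʳ (R̂ r) _ h)))
      (leftmostPlus-plus (∧-conicalˡ _ _ h) 1≤r r≤n)

  chargedRows-aₙ : chargedRows aₙ ≡ plusesD̂ aₙ
  chargedRows-aₙ = count-cong n charged-aₙ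
    where
    charged-aₙ : OnLabels (λ r → chargedTo r aₙ ≡ plusAt R̂ P̂ r aₙ) n
    charged-aₙ r 1≤r r≤n with true-or-false (R̂ r)
    ... | inj₂ r̂ = trans (chargedTo-nonRow r̂) (sym (plusAt-nonRow {R̂} {P̂} r̂))
    ... | inj₁ r̂ with true-or-false (typeII r)
    ...   | inj₁ type = trans (trans (chargedTo-row r̂) (cong (_≡ᵇ aₙ) (charge-typeII type)))
                              (trans (≡⇒≡ᵇ≡true {aₙ} refl) (sym (∧-conicalʳ (R̂ r) _ type)))
    ...   | inj₂ notII = trans (trans (chargedTo-row r̂) (cong (_≡ᵇ aₙ) (charge-notII notII)))
                               (trans (≢⇒≡ᵇ≡false L≢aₙ) (sym noPlus))
      where
      noPlus : plusAt R̂ P̂ r aₙ ≡ false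
      noPlus = trans (sym (cong (_∧ plusAt R̂ P̂ r aₙ) r̂)) notII
      L≢aₙ : leftmostPlus r ≢ aₙ
      L≢aₙ L≡aₙ = not-¬ (trans (cong (plusAt R̂ P̂ r) (sym L≡aₙ)) (leftmostPlus-plus r̂ 1≤r r≤n)) noPlus

  charged-nonColumn : ∀ {ℓ} → R̂ ℓ ≡ true → OnLabels (λ r → chargedTo r ℓ ≡ false) n
  charged-nonColumn {ℓ} rℓ r 1≤r r≤n with true-or-false (R̂ r)
  ... | inj₂ r̂ = chargedTo-nonRow r̂
  ... | inj₁ r̂ = trans (chargedTo-row r̂)
                       (≢⇒≡ᵇ≡false (λ c≡ℓ → not-¬ rℓ (trans (cong R̂ (sym c≡ℓ)) (proj₁ (charge-spec r̂ 1≤r r≤n)))))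

  label-identity : ∀ ℓ → 1 ≤ ℓ → ℓ ≤ n →
    plusesD ℓ + chargedRows ℓ + toℕ (R̂ ℓ) + toℕ (aₙ ≡ᵇ ℓ) ≡ plusesD̂ ℓ + 1
  label-identity ℓ 1≤ℓ ℓ≤n with true-or-false (R̂ ℓ)
  ... | inj₁ rℓ rewrite count-false n (λ r _ _ → plusAt-nonColumn {rowD} {plusD} {r} (rowD-row rℓ))
                      | count-false n (λ r _ _ → plusAt-nonColumn {R̂} {P̂} {r} rℓ)
                      | count-false n (charged-nonColumn rℓ) | rℓ | ≢⇒≡ᵇ≡false (≢-sym (row≢aₙ rℓ)) = refl
  ... | inj₂ rℓ with ℓ ≟ aₙ
  ...   | yes refl = begin
    plusesD aₙ + chargedRows aₙ + toℕ (R̂ aₙ) + toℕ (aₙ ≡ᵇ aₙ)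
      ≡⟨ cong₂ (λ u v → u + chargedRows aₙ + toℕ v + toℕ (aₙ ≡ᵇ aₙ)) plusesD-aₙ rℓ ⟩
    chargedRows aₙ + 0 + toℕ (aₙ ≡ᵇ aₙ)
      ≡⟨ cong₂ (λ u v → u + toℕ v) (trans (+-identityʳ _) chargedRows-aₙ) (≡⇒≡ᵇ≡true {aₙ} refl) ⟩
    plusesD̂ aₙ + 1 ∎
    where
    open ≡-Reasoning
    plusesD-aₙ : plusesD aₙ ≡ 0
    plusesD-aₙ = count-false n (λ r _ _ → plusAt-nonColumn {rowD} {plusD} {r} rowD-aₙ)
  ...   | no ℓ≢aₙ = trans (cong₂ (λ u v → plusesD ℓ + chargedRows ℓ + toℕ u + toℕ v) rℓ (≢⇒≡ᵇ≡false (≢-sym ℓ≢aₙ)))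
    (trans (+-identityʳ _) (trans (+-identityʳ _) (Column.column-identity ℓ 1≤ℓ ℓ≤n rℓ ℓ≢aₙ)))

  rows-total : sumTo (toℕ ∘ R̂) n ≡ k
  rows-total = trans (sym (count≡sumTo R̂ n)) (rowCount Dh)

  chargedRows-total : sumTo chargedRows n ≡ k
  chargedRows-total = begin
    sumTo chargedRows n                     ≡⟨ count-swap chargedTo n n ⟨
    sumTo (λ r → count (chargedTo r) n) n   ≡⟨ sumTo-cong n chargedOnce ⟩
    sumTo (toℕ ∘ R̂) n                       ≡⟨ rows-total ⟩
    k                                       ∎
    where
    open ≡-Reasoning
    chargedOnce : OnLabels (λ r → count (chargedTo r) n ≡ toℕ (R̂ r)) n
    chargedOnce r 1≤r r≤n with true-or-false (R̂ r)
    ... | inj₂ r̂ = trans (count-false n (λ ℓ _ _ → chargedTo-nonRow r̂)) (cong toℕ (sym r̂))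
    ... | inj₁ r̂ = trans (count-cong n (λ ℓ _ _ → chargedTo-row r̂))
                         (trans (count-≡ᵇ (charge r) n (≤-trans 1≤r (<⇒≤ (proj₁ (proj₂ spec)))) (proj₂ (proj₂ spec)))
                                (cong toℕ (sym r̂)))
      where
      spec : R̂ (charge r) ≡ false × r < charge r × charge r ≤ n
      spec = charge-spec r̂ 1≤r r≤n

  aₙ-total : sumTo (λ ℓ → toℕ (aₙ ≡ᵇ ℓ)) n ≡ 1
  aₙ-total = trans (sym (count≡sumTo (aₙ ≡ᵇ_) n)) (count-≡ᵇ aₙ n 1≤aₙ aₙ≤n)

  plus-count-identity : numPlus n rowD plusD + k + k + 1 ≡ numPlus n R̂ P̂ + n
  plus-count-identity = begin
    numPlus n rowD plusD + k + k + 1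
      ≡⟨ cong₂ _+_ (cong₂ _+_ (cong₂ _+_ (sym (count-swap (plusAt rowD plusD) n n)) chargedRows-total) rows-total) aₙ-total ⟨
    sumTo plusesD n + sumTo chargedRows n + sumTo (toℕ ∘ R̂) n + sumTo (λ ℓ → toℕ (aₙ ≡ᵇ ℓ)) n
      ≡⟨ trans (sumTo-+ _ _ n) (cong (_+ sumTo (λ ℓ → toℕ (aₙ ≡ᵇ ℓ)) n)
                (trans (sumTo-+ _ _ n) (cong (_+ sumTo (toℕ ∘ R̂) n) (sumTo-+ plusesD chargedRows n)))) ⟨
    sumTo (λ ℓ → plusesD ℓ + chargedRows ℓ + toℕ (R̂ ℓ) + toℕ (aₙ ≡ᵇ ℓ)) n
      ≡⟨ sumTo-cong n label-identity ⟩
    sumTo (λ ℓ → plusesD̂ ℓ + 1) n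
      ≡⟨ sumTo-+ plusesD̂ (λ _ → 1) n ⟩
    sumTo plusesD̂ n + sumTo (λ _ → 1) n
      ≡⟨ cong₂ _+_ (sym (count-swap (plusAt R̂ P̂) n n)) (trans (sumTo-const 1 n) (*-identityʳ n)) ⟩
    numPlus n R̂ P̂ + n ∎
    where open ≡-Reasoning

  dimension : numPlus n rowD plusD + 2 * k ≡ numPlus n R̂ P̂ + (n ∸ 1)
  dimension = +-cancelʳ-≡ 1 _ _ (begin
    numPlus n rowD plusD + 2 * k + 1
      ≡⟨ solve 2 (λ d k → d :+ con 2 :* k :+ con 1 := d :+ k :+ k :+ con 1) refl (numPlus n rowD plusD) k ⟩
    numPlus n rowD plusD + k + k + 1   ≡⟨ plus-count-identity ⟩
    numPlus n R̂ P̂ + n                  ≡⟨ cong (numPlus n R̂ P̂ +_) (m∸n+n≡m 1≤n) ⟨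
    numPlus n R̂ P̂ + (n ∸ 1 + 1)        ≡⟨ +-assoc (numPlus n R̂ P̂) (n ∸ 1) 1 ⟨
    numPlus n R̂ P̂ + (n ∸ 1) + 1        ∎)
    where open ≡-Reasoning

  loopless : Loopless n rowD plusD
  loopless ℓ 1≤ℓ ℓ≤n notRowD with count-witness n (+-cancelʳ-≤ (plusesD̂ ℓ) 1 (plusesD ℓ) bound)
    where
    ℓcol : R̂ ℓ ≡ false
    ℓcol = ∨-conicalˡ (R̂ ℓ) _ notRowD
    ℓ≢aₙ : ℓ ≢ aₙ
    ℓ≢aₙ ℓ≡aₙ = not-¬ (≡⇒≡ᵇ≡true ℓ≡aₙ) (∨-conicalʳ (R̂ ℓ) _ notRowD)
    charged≤plus : chargedRows ℓ ≤ plusesD̂ ℓ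
    charged≤plus = count-mono n (λ r 1≤r r≤n → charged-plus 1≤r r≤n ℓ≢aₙ)
    bound : 1 + plusesD̂ ℓ ≤ plusesD ℓ + plusesD̂ ℓ
    bound = subst (_≤ plusesD ℓ + plusesD̂ ℓ)
      (trans (Column.column-identity ℓ 1≤ℓ ℓ≤n ℓcol ℓ≢aₙ) (+-comm (plusesD̂ ℓ) 1)) (+-monoʳ-≤ (plusesD ℓ) charged≤plus)
  ... | r , 1≤r , _ , plus = r , 1≤r , plus

mainTheorem10 : ∀ {k n : ℕ} (Dh : LeDiagram k n) → 1 ≤ n → CoLoopless Dh →
    Loopless n (algRow Dh) (algPlus Dh)
    × numPlus n (algRow Dh) (algPlus Dh) + 2 * k ≡ numPlus n (isRow Dh) (plus Dh) + (n ∸ 1)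
mainTheorem10 Dh 1≤n coloopless = loopless , dimension
  where open Construction Dh 1≤n coloopless
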